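{- $\tau\ge\frac1{10}$; i.e., every $n$-vertex oriented graph $G$ satisfies $t(G)+i(G)\ge\frac1{10}-o_n(1)$.
   Context: An oriented graph is a directed graph with no loops and no multiple (parallel or anti-parallel) edges. $t(G)$ (resp. $i(G)$) is the probability that a uniformly random $3$-set of vertices of $G$ induces a transitive triangle (resp. an independent set). $\tau=\lim_{n\to\infty}\tau(n)$, where $\tau(n)=\min\{t(G)+i(G): G$ an $n$-vertex oriented graph$\}$. -}

module Defs where

open import Data.Bool using (Bool; true; false; _∧_; _∨_; not; if_then_else_)
open import Data.Nat using (ℕ; zero; suc; _+_; _*_)
open import Data.Nat.Combinatorics using (_C_)
open import Data.Fin using (Fin; _<?_)
open import Data.List using (List; concatMap; map; allFin)
open import Data.Nat.ListAction using (sum)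
open import Data.Product using (_×_; _,_)
open import Relation.Nullary.Decidable using (⌊_⌋)
open import Relation.Binary.PropositionalEquality using (_≡_)
open import Data.Integer using (+_)
open import Data.Rational using (ℚ; _/_)

-- An oriented graph on vertex set Fin n: a directed graph (adj u v = true
-- means an arc u → v) with no loops and no pair of anti-parallel arcs.
-- (Multiple parallel arcs are impossible for a Bool-valued relation.)
record OrientedGraph (n : ℕ) : Set where
  field
    adj     : Fin n → Fin n → Bool
    noLoop  : ∀ v → adj v v ≡ false
    antisym : ∀ u v → adj u v ≡ true → adj v u ≡ false
open OrientedGraph public

module _ {n : ℕ} (G : OrientedGraph n) where
  joined : Fin n → Fin n → Bool
  joined u v = adj G u v ∨ adj G v u

  cyclic : Fin n → Fin n → Fin n → Bool
  cyclic a b c = (adj G a b ∧ adj G b c ∧ adj G c a)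
               ∨ (adj G a c ∧ adj G c b ∧ adj G b a)

  transitiveTri : Fin n → Fin n → Fin n → Bool
  transitiveTri a b c = joined a b ∧ joined b c ∧ joined a c ∧ not (cyclic a b c)

  independent3 : Fin n → Fin n → Fin n → Bool
  independent3 a b c = not (joined a b) ∧ not (joined b c) ∧ not (joined a c)

  count3 : (Fin n → Fin n → Fin n → Bool) → ℕ
  count3 P = sum (concatMap (λ a → concatMap (λ b → map (λ c →
      if ⌊ a <? b ⌋ ∧ ⌊ b <? c ⌋ ∧ P a b c then 1 else 0)
      (allFin n)) (allFin n)) (allFin n))

  T# : ℕ
  T# = count3 transitiveTri

  I# : ℕ
  I# = count3 independent3

ℕ→ℚ : ℕ → ℚ
ℕ→ℚ m = + m / 1

-- For a vertex v of an n-vertex oriented graph let P, Q and R be the numbers of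
-- its out-, in- and non-neighbours, so P + Q + R = n - 1.  The quadratic form
-- W v = (P - R)² + (Q - R)² + P² + Q² satisfies 5 W v ≥ (P + Q + R)², and W v is
-- the sum, over ordered pairs (a, b), of a Gram-type weight w v a b depending only
-- on how a and b are joined to v.  Summing over all ordered triples (v, a, b), the
-- degenerate triples contribute at most 2n², and the six orderings of a 3-set
-- together contribute at most 12 if it induces a transitive triangle or an
-- independent set and at most 0 otherwise (an exhaustive check over the 27
-- orientations of a triangle).  Hence n (n - 1)² ≤ 60 (T# + I#) + 10 n², that is
-- t(G) + i(G) ≥ 1/10 - O(1/n).
module Submission where

-- A separate module, since its ℤ operators clash with the ℕ and ℚ ones of the statement.
module Density where

  open import Data.Nat as ℕ using (ℕ; zero; suc; z≤n)
  open import Data.Nat.Combinatorics using (_C_; nC1≡n; nCk+nC[k+1]≡[n+1]C[k+1])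
  import Data.Nat.ListAction as List
  open import Data.Nat.ListAction.Properties using (sum-++)
  open import Data.Integer as ℤ using (ℤ; +_; +0; +[1+_]; -[1+_]; _+_; _*_; _-_; -_; _≤_; +≤+; -1ℤ)
  open import Data.Integer.Properties hiding (_≟_; _<?_; <-cmp; <-trans; <⇒≢)
  open import Data.Integer.Tactic.RingSolver using (solve-∀)
  open import Data.Fin using (Fin; zero; suc; _≟_; _<?_; _<_)
  open import Data.Fin.Patterns using (0F; 1F; 2F; 3F)
  open import Data.Fin.Permutation using (permutation)
  open import Data.Fin.Properties using (suc-injective; <-cmp; <-trans; <⇒≢)
  open import Data.Bool using (Bool; true; false; T; not; _∧_; _∨_; if_then_else_)
  open import Data.Bool.Properties using (T-∧)
  open import Data.Empty using (⊥-elim)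
  open import Data.List using (List; _++_; map; concatMap; tabulate; allFin)
  open import Data.Product using (_,_; proj₁; proj₂)
  open import Data.Rational as ℚ using (ℚ; mkℚ; _/_; toℚᵘ; ↥_; ↧_)
  open import Data.Rational.Properties
    using (toℚᵘ-cancel-≤; toℚᵘ-homo-*; toℚᵘ-homo-+; toℚᵘ-homo‿-; toℚᵘ-fromℚᵘ)
  open import Data.Rational.Unnormalised as ℚᵘ using (mkℚᵘ; *≤*; _≃_)
  import Data.Rational.Unnormalised.Properties as ℚᵘ
  open import Data.Unit using (tt)
  open import Data.Vec using (Vec; []; _∷_)
  open import Function.Bundles using (Equivalence)
  open import Relation.Binary.Definitions using (tri<; tri≈; tri>)
  open import Relation.Binary.PropositionalEquality
  open import Relation.Nullary using (Dec; yes; no; ¬_)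
  open import Relation.Nullary.Decidable
    using (⌊_⌋; ⌊⌋-map′; isYes≗does; dec-true; dec-false; toWitness; fromWitness)
  open import Algebra.Properties.Semiring.Sum +-*-semiring
    using (sum; sum-syntax; ∑-distrib-+; ∑-comm; ∑-permute; *-distribˡ-sum; *-distribʳ-sum; sum-cong-≗)
  open import Defs

  -- Written with + (…) so that the summands of count3 are literally indicator values.
  ⟦_⟧ : Bool → ℤ
  ⟦ b ⟧ = + (if b then 1 else 0)

  ∑-mono-≤ : ∀ {n} {f g : Fin n → ℤ} → (∀ i → f i ≤ g i) → sum f ≤ sum g
  ∑-mono-≤ {zero}  f≤g = ≤-refl
  ∑-mono-≤ {suc n} f≤g = +-mono-≤ (f≤g zero) (∑-mono-≤ (λ i → f≤g (suc i)))

  ∑-const : ∀ n c → ∑[ i < n ] c ≡ + n * c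
  ∑-const zero    c = refl
  ∑-const (suc n) c = begin
    c + ∑[ i < n ] c   ≡⟨ cong (_+_ c) (∑-const n c) ⟩
    c + + n * c        ≡⟨ cong (_+ + n * c) (*-identityˡ c) ⟨
    + 1 * c + + n * c  ≡⟨ *-distribʳ-+ c (+ 1) (+ n) ⟨
    + suc n * c        ∎
    where open ≡-Reasoning

  ∑-indicator-≟ : ∀ {n} (i : Fin n) → ∑[ j < n ] ⟦ ⌊ i ≟ j ⌋ ⟧ ≡ + 1
  ∑-indicator-≟ {suc n} zero    = cong (_+_ (+ 1)) (trans (∑-const n (+ 0)) (*-zeroʳ (+ n)))
  ∑-indicator-≟ {suc n} (suc i) = begin
    + 0 + ∑[ j < n ] ⟦ ⌊ suc i ≟ suc j ⌋ ⟧  ≡⟨ +-identityˡ _ ⟩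
    ∑[ j < n ] ⟦ ⌊ suc i ≟ suc j ⌋ ⟧        ≡⟨ sum-cong-≗ (λ j → cong ⟦_⟧ (⌊⌋-map′ (cong suc) suc-injective (i ≟ j))) ⟩
    ∑[ j < n ] ⟦ ⌊ i ≟ j ⌋ ⟧                ≡⟨ ∑-indicator-≟ i ⟩
    + 1                                     ∎
    where open ≡-Reasoning

  ∑-distrib-- : ∀ {n} (f g : Fin n → ℤ) → ∑[ i < n ] (f i - g i) ≡ sum f - sum g
  ∑-distrib-- f g = begin
    ∑[ i < _ ] (f i - g i)          ≡⟨ ∑-distrib-+ f (λ i → - g i) ⟩
    sum f + ∑[ i < _ ] (- g i)      ≡⟨ cong (_+_ (sum f)) (sum-cong-≗ (λ i → -1*i≡-i (g i))) ⟨
    sum f + ∑[ i < _ ] (-1ℤ * g i)  ≡⟨ cong (_+_ (sum f)) (*-distribˡ-sum -1ℤ g) ⟨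
    sum f + -1ℤ * sum g             ≡⟨ cong (_+_ (sum f)) (-1*i≡-i (sum g)) ⟩
    sum f - sum g                   ∎
    where open ≡-Reasoning

  ∑∑-*≡∑*∑ : ∀ {m n} (f : Fin m → ℤ) (g : Fin n → ℤ) → ∑[ i < m ] ∑[ j < n ] (f i * g j) ≡ sum f * sum g
  ∑∑-*≡∑*∑ f g = begin
    ∑[ i < _ ] ∑[ j < _ ] (f i * g j)  ≡⟨ sum-cong-≗ (λ i → *-distribˡ-sum (f i) g) ⟨
    ∑[ i < _ ] (f i * sum g)           ≡⟨ *-distribʳ-sum (sum g) f ⟨
    sum f * sum g                      ∎
    where open ≡-Reasoning

  ∑∑-gram : ∀ {m n} (φ : Fin m → Fin n → ℤ) →
            ∑[ a < n ] ∑[ b < n ] ∑[ k < m ] (φ k a * φ k b) ≡ ∑[ k < m ] (sum (φ k) * sum (φ k))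
  ∑∑-gram φ = begin
    ∑[ a < _ ] ∑[ b < _ ] ∑[ k < _ ] (φ k a * φ k b)  ≡⟨ sum-cong-≗ (λ a → ∑-comm (λ b k → φ k a * φ k b)) ⟩
    ∑[ a < _ ] ∑[ k < _ ] ∑[ b < _ ] (φ k a * φ k b)  ≡⟨ ∑-comm (λ a k → ∑[ b < _ ] (φ k a * φ k b)) ⟩
    ∑[ k < _ ] ∑[ a < _ ] ∑[ b < _ ] (φ k a * φ k b)  ≡⟨ sum-cong-≗ (λ k → ∑∑-*≡∑*∑ (φ k) (φ k)) ⟩
    ∑[ k < _ ] (sum (φ k) * sum (φ k))                ∎
    where open ≡-Reasoning

  ∑³ : ∀ {n} → (Fin n → Fin n → Fin n → ℤ) → ℤ
  ∑³ {n} f = ∑[ x < n ] ∑[ y < n ] ∑[ z < n ] f x y z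

  ∑³-cong : ∀ {n} {f g : Fin n → Fin n → Fin n → ℤ} → (∀ x y z → f x y z ≡ g x y z) → ∑³ f ≡ ∑³ g
  ∑³-cong f≡g = sum-cong-≗ (λ x → sum-cong-≗ (λ y → sum-cong-≗ (f≡g x y)))

  ∑³-mono-≤ : ∀ {n} {f g : Fin n → Fin n → Fin n → ℤ} → (∀ x y z → f x y z ≤ g x y z) → ∑³ f ≤ ∑³ g
  ∑³-mono-≤ f≤g = ∑-mono-≤ (λ x → ∑-mono-≤ (λ y → ∑-mono-≤ (f≤g x y)))

  ∑³-distrib-+ : ∀ {n} (f g : Fin n → Fin n → Fin n → ℤ) → ∑³ (λ x y z → f x y z + g x y z) ≡ ∑³ f + ∑³ g
  ∑³-distrib-+ f g = trans
    (sum-cong-≗ (λ x → trans (sum-cong-≗ (λ y → ∑-distrib-+ (f x y) (g x y)))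
                             (∑-distrib-+ (λ y → sum (f x y)) (λ y → sum (g x y)))))
    (∑-distrib-+ (λ x → ∑[ y < _ ] sum (f x y)) (λ x → ∑[ y < _ ] sum (g x y)))

  ∑³-*ˡ : ∀ {n} c (f : Fin n → Fin n → Fin n → ℤ) → ∑³ (λ x y z → c * f x y z) ≡ c * ∑³ f
  ∑³-*ˡ c f = sym (trans (*-distribˡ-sum c (λ x → ∑[ y < _ ] sum (f x y)))
    (sum-cong-≗ (λ x → trans (*-distribˡ-sum c (λ y → sum (f x y)))
                             (sum-cong-≗ (λ y → *-distribˡ-sum c (f x y))))))

  ∑³-swap₁₂ : ∀ {n} (f : Fin n → Fin n → Fin n → ℤ) → ∑³ f ≡ ∑³ (λ x y z → f y x z)
  ∑³-swap₁₂ f = ∑-comm (λ x y → ∑[ z < _ ] f x y z)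

  ∑³-swap₂₃ : ∀ {n} (f : Fin n → Fin n → Fin n → ℤ) → ∑³ f ≡ ∑³ (λ x y z → f x z y)
  ∑³-swap₂₃ f = sum-cong-≗ (λ x → ∑-comm (f x))

  ∑³-∑-comm : ∀ {m n} (h : Fin m → Fin n → Fin n → Fin n → ℤ) →
              ∑³ (λ x y z → ∑[ k < m ] h k x y z) ≡ ∑[ k < m ] ∑³ (h k)
  ∑³-∑-comm h = begin
    ∑[ x < _ ] ∑[ y < _ ] ∑[ z < _ ] ∑[ k < _ ] h k x y z
      ≡⟨ sum-cong-≗ (λ x → sum-cong-≗ (λ y → ∑-comm (λ z k → h k x y z))) ⟩
    ∑[ x < _ ] ∑[ y < _ ] ∑[ k < _ ] ∑[ z < _ ] h k x y z
      ≡⟨ sum-cong-≗ (λ x → ∑-comm (λ y k → ∑[ z < _ ] h k x y z)) ⟩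
    ∑[ x < _ ] ∑[ k < _ ] ∑[ y < _ ] ∑[ z < _ ] h k x y z
      ≡⟨ ∑-comm (λ x k → ∑[ y < _ ] ∑[ z < _ ] h k x y z) ⟩
    ∑[ k < _ ] ∑³ (h k)
      ∎
    where open ≡-Reasoning

  -- Symmetrisation over the six relabellings of a triple

  pattern xyz = zero
  pattern xzy = suc zero
  pattern yxz = suc (suc zero)
  pattern yzx = suc (suc (suc zero))
  pattern zxy = suc (suc (suc (suc zero)))
  pattern zyx = suc (suc (suc (suc (suc zero))))

  relabel : ∀ {n} → Fin 6 → (Fin n → Fin n → Fin n → ℤ) → Fin n → Fin n → Fin n → ℤ
  relabel xyz f x y z = f x y z
  relabel xzy f x y z = f x z y
  relabel yxz f x y z = f y x z
  relabel yzx f x y z = f y z x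
  relabel zxy f x y z = f z x y
  relabel zyx f x y z = f z y x

  _⁻¹ : Fin 6 → Fin 6
  yzx ⁻¹ = zxy
  zxy ⁻¹ = yzx
  σ   ⁻¹ = σ

  ⁻¹-involutive : ∀ σ → σ ⁻¹ ⁻¹ ≡ σ
  ⁻¹-involutive xyz = refl
  ⁻¹-involutive xzy = refl
  ⁻¹-involutive yxz = refl
  ⁻¹-involutive yzx = refl
  ⁻¹-involutive zxy = refl
  ⁻¹-involutive zyx = refl

  ∑-reindex-⁻¹ : (F : Fin 6 → ℤ) → ∑[ σ < 6 ] F σ ≡ ∑[ σ < 6 ] F (σ ⁻¹)
  ∑-reindex-⁻¹ F = ∑-permute F (permutation _⁻¹ _⁻¹ ⁻¹-involutive ⁻¹-involutive)

  symmetrise : ∀ {n} → (Fin n → Fin n → Fin n → ℤ) → Fin n → Fin n → Fin n → ℤ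
  symmetrise f x y z = ∑[ σ < 6 ] relabel σ f x y z

  symmetrise-expand : ∀ {n} (f : Fin n → Fin n → Fin n → ℤ) x y z →
    symmetrise f x y z ≡ f x y z + f x z y + f y x z + f y z x + f z x y + f z y x
  symmetrise-expand f x y z = flatten (f x y z) (f x z y) (f y x z) (f y z x) (f z x y) (f z y x)
    where
    flatten : ∀ a b c d e g → a + (b + (c + (d + (e + (g + + 0))))) ≡ a + b + c + d + e + g
    flatten = solve-∀

  ∑³-relabel-adjoint : ∀ {n} σ (g f : Fin n → Fin n → Fin n → ℤ) →
    ∑³ (λ x y z → g x y z * relabel σ f x y z) ≡ ∑³ (λ x y z → relabel (σ ⁻¹) g x y z * f x y z)
  ∑³-relabel-adjoint xyz g f = refl
  ∑³-relabel-adjoint xzy g f = ∑³-swap₂₃ (λ x y z → g x y z * f x z y)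
  ∑³-relabel-adjoint yxz g f = ∑³-swap₁₂ (λ x y z → g x y z * f y x z)
  ∑³-relabel-adjoint yzx g f = trans (∑³-swap₁₂ h) (∑³-swap₂₃ (λ x y z → h y x z))
    where h = λ x y z → g x y z * f y z x
  ∑³-relabel-adjoint zxy g f = trans (∑³-swap₂₃ h) (∑³-swap₁₂ (λ x y z → h x z y))
    where h = λ x y z → g x y z * f z x y
  ∑³-relabel-adjoint zyx g f =
    trans (∑³-swap₁₂ h) (trans (∑³-swap₂₃ (λ x y z → h y x z)) (∑³-swap₁₂ (λ x y z → h z x y)))
    where h = λ x y z → g x y z * f z y x

  ∑³-symmetrise-adjoint : ∀ {n} (g f : Fin n → Fin n → Fin n → ℤ) →
    ∑³ (λ x y z → g x y z * symmetrise f x y z) ≡ ∑³ (λ x y z → symmetrise g x y z * f x y z)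
  ∑³-symmetrise-adjoint g f = begin
    ∑³ (λ x y z → g x y z * symmetrise f x y z)
      ≡⟨ ∑³-cong (λ x y z → *-distribˡ-sum (g x y z) (λ σ → relabel σ f x y z)) ⟩
    ∑³ (λ x y z → ∑[ σ < 6 ] (g x y z * relabel σ f x y z))
      ≡⟨ ∑³-∑-comm (λ σ x y z → g x y z * relabel σ f x y z) ⟩
    ∑[ σ < 6 ] ∑³ (λ x y z → g x y z * relabel σ f x y z)
      ≡⟨ sum-cong-≗ (λ σ → ∑³-relabel-adjoint σ g f) ⟩
    ∑[ σ < 6 ] ∑³ (λ x y z → relabel (σ ⁻¹) g x y z * f x y z)
      ≡⟨ ∑-reindex-⁻¹ (λ σ → ∑³ (λ x y z → relabel σ g x y z * f x y z)) ⟨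
    ∑[ σ < 6 ] ∑³ (λ x y z → relabel σ g x y z * f x y z)
      ≡⟨ ∑³-∑-comm (λ σ x y z → relabel σ g x y z * f x y z) ⟨
    ∑³ (λ x y z → ∑[ σ < 6 ] (relabel σ g x y z * f x y z))
      ≡⟨ ∑³-cong (λ x y z → *-distribʳ-sum (f x y z) (λ σ → relabel σ g x y z)) ⟨
    ∑³ (λ x y z → symmetrise g x y z * f x y z)
      ∎
    where open ≡-Reasoning

  infixr 4 _⇒ᵇ_

  _⇒ᵇ_ : Bool → Bool → Bool
  a ⇒ᵇ b = not a ∨ b

  ∧-intro : ∀ {a b} → T a → T b → T (a ∧ b)
  ∧-intro p q = Equivalence.from T-∧ (p , q)

  every : ∀ k → (Vec Bool k → Bool) → Bool
  every zero    f = f []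
  every (suc k) f = every k (λ bs → f (true ∷ bs)) ∧ every k (λ bs → f (false ∷ bs))

  every-sound : ∀ k f → T (every k f) → ∀ bs → T (f bs)
  every-sound zero    f holds []           = holds
  every-sound (suc k) f holds (true ∷ bs)  = every-sound k _ (proj₁ (Equivalence.to T-∧ holds)) bs
  every-sound (suc k) f holds (false ∷ bs) = every-sound k _ (proj₂ (Equivalence.to T-∧ holds)) bs

  by-evaluation : ∀ k (c p : Vec Bool k → Bool) →
                  T (every k (λ bs → c bs ⇒ᵇ p bs)) → ∀ bs → T (c bs) → T (p bs)
  by-evaluation k c p holds bs cbs with c bs | every-sound k _ holds bs
  ... | true | pbs = pbs

  ⌊⌋-true : ∀ {A : Set} (a? : Dec A) → A → ⌊ a? ⌋ ≡ true
  ⌊⌋-true a? a = trans (isYes≗does a?) (dec-true a? a)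

  ⌊⌋-false : ∀ {A : Set} (a? : Dec A) → ¬ A → ⌊ a? ⌋ ≡ false
  ⌊⌋-false a? ¬a = trans (isYes≗does a?) (dec-false a? ¬a)

  exactlyOne : Bool → Bool → Bool → Bool
  exactlyOne a b c = (a ∧ not b ∧ not c) ∨ (not a ∧ b ∧ not c) ∨ (not a ∧ not b ∧ c)

  module _ {n : ℕ} where

    trichotomyᵇ : (x y : Fin n) → T (exactlyOne ⌊ x <? y ⌋ ⌊ y <? x ⌋ ⌊ x ≟ y ⌋)
    trichotomyᵇ x y with <-cmp x y
    ... | tri< x<y x≢y y≮x rewrite ⌊⌋-true (x <? y) x<y | ⌊⌋-false (y <? x) y≮x | ⌊⌋-false (x ≟ y) x≢y = tt
    ... | tri≈ x≮y x≡y y≮x rewrite ⌊⌋-false (x <? y) x≮y | ⌊⌋-false (y <? x) y≮x | ⌊⌋-true (x ≟ y) x≡y = tt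
    ... | tri> x≮y x≢y y<x rewrite ⌊⌋-false (x <? y) x≮y | ⌊⌋-true (y <? x) y<x | ⌊⌋-false (x ≟ y) x≢y = tt

    transitiveᵇ : (x y z : Fin n) → T (⌊ x <? y ⌋ ∧ ⌊ y <? z ⌋ ⇒ᵇ ⌊ x <? z ⌋)
    transitiveᵇ x y z with x <? y | y <? z
    ... | yes x<y | yes y<z = fromWitness (<-trans x<y y<z)
    ... | yes _   | no _    = tt
    ... | no _    | _       = tt

    ascending : Fin n → Fin n → Fin n → Bool
    ascending x y z = ⌊ x <? y ⌋ ∧ ⌊ y <? z ⌋

    distinct : Fin n → Fin n → Fin n → Bool
    distinct x y z = not (⌊ x ≟ y ⌋ ∨ ⌊ y ≟ z ⌋ ∨ ⌊ x ≟ z ⌋)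

    ascending∧ : Fin n → Fin n → Fin n → Bool → ℤ
    ascending∧ x y z b = ⟦ ⌊ x <? y ⌋ ∧ ⌊ y <? z ⌋ ∧ b ⟧

    -- Checked on the nine comparison bits, constrained only by trichotomy and transitivity.
    symmetrise-ascending : (x y z : Fin n) →
      symmetrise (λ a b c → ⟦ ascending a b c ⟧) x y z ≡ ⟦ distinct x y z ⟧
    symmetrise-ascending x y z = trans (symmetrise-expand (λ a b c → ⟦ ascending a b c ⟧) x y z)
      (toWitness (by-evaluation 9 consistent counts tt
        (⌊ x <? y ⌋ ∷ ⌊ y <? x ⌋ ∷ ⌊ x ≟ y ⌋ ∷ ⌊ y <? z ⌋ ∷ ⌊ z <? y ⌋ ∷ ⌊ y ≟ z ⌋ ∷
         ⌊ x <? z ⌋ ∷ ⌊ z <? x ⌋ ∷ ⌊ x ≟ z ⌋ ∷ [])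
        (∧-intro (trichotomyᵇ x y) (∧-intro (trichotomyᵇ y z) (∧-intro (trichotomyᵇ x z)
        (∧-intro (transitiveᵇ x y z) (∧-intro (transitiveᵇ x z y) (∧-intro (transitiveᵇ y x z)
        (∧-intro (transitiveᵇ y z x) (∧-intro (transitiveᵇ z x y) (transitiveᵇ z y x)))))))))))
      where
      consistent counts : Vec Bool 9 → Bool
      consistent (xy ∷ yx ∷ x≡y ∷ yz ∷ zy ∷ y≡z ∷ xz ∷ zx ∷ x≡z ∷ []) =
        exactlyOne xy yx x≡y ∧ exactlyOne yz zy y≡z ∧ exactlyOne xz zx x≡z ∧
        (xy ∧ yz ⇒ᵇ xz) ∧ (xz ∧ zy ⇒ᵇ xy) ∧ (yx ∧ xz ⇒ᵇ yz) ∧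
        (yz ∧ zx ⇒ᵇ yx) ∧ (zx ∧ xy ⇒ᵇ zy) ∧ (zy ∧ yx ⇒ᵇ zx)
      counts (xy ∷ yx ∷ x≡y ∷ yz ∷ zy ∷ y≡z ∷ xz ∷ zx ∷ x≡z ∷ []) =
        ⌊ ⟦ xy ∧ yz ⟧ + ⟦ xz ∧ zy ⟧ + ⟦ yx ∧ xz ⟧ + ⟦ yz ∧ zx ⟧ + ⟦ zx ∧ xy ⟧ + ⟦ zy ∧ yx ⟧
          ℤ.≟ ⟦ not (x≡y ∨ y≡z ∨ x≡z) ⟧ ⌋

    ∑³-distinct : (f : Fin n → Fin n → Fin n → ℤ) →
      ∑³ (λ x y z → ⟦ distinct x y z ⟧ * f x y z)
      ≡ ∑³ (λ x y z → ⟦ ascending x y z ⟧ * symmetrise f x y z)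
    ∑³-distinct f = sym (trans (∑³-symmetrise-adjoint (λ x y z → ⟦ ascending x y z ⟧) f)
                               (∑³-cong (λ x y z → cong (_* f x y z) (symmetrise-ascending x y z))))

  sum-map-tabulate : ∀ {A : Set} {n} (h : Fin n → A) (g : A → ℕ) →
                     + List.sum (map g (tabulate h)) ≡ ∑[ i < n ] (+ g (h i))
  sum-map-tabulate {n = zero}  h g = refl
  sum-map-tabulate {n = suc n} h g =
    trans (pos-+ (g (h zero)) _) (cong (_+_ (+ g (h zero))) (sum-map-tabulate (λ i → h (suc i)) g))

  sum-concatMap-tabulate : ∀ {A : Set} {n} (h : Fin n → A) (f : A → List ℕ) →
                           + List.sum (concatMap f (tabulate h)) ≡ ∑[ i < n ] (+ List.sum (f (h i)))
  sum-concatMap-tabulate {n = zero}  h f = refl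
  sum-concatMap-tabulate {n = suc n} h f = begin
    + List.sum (f (h zero) ++ concatMap f (tabulate (λ i → h (suc i))))
      ≡⟨ cong +_ (sum-++ (f (h zero)) _) ⟩
    + (List.sum (f (h zero)) ℕ.+ List.sum (concatMap f (tabulate (λ i → h (suc i)))))
      ≡⟨ pos-+ (List.sum (f (h zero))) _ ⟩
    + List.sum (f (h zero)) + + List.sum (concatMap f (tabulate (λ i → h (suc i))))
      ≡⟨ cong (_+_ (+ List.sum (f (h zero)))) (sum-concatMap-tabulate (λ i → h (suc i)) f) ⟩
    ∑[ i < suc n ] (+ List.sum (f (h i)))
      ∎
    where open ≡-Reasoning

  count3-∑³ : ∀ {n} (G : OrientedGraph n) (P : Fin n → Fin n → Fin n → Bool) →
              + count3 G P ≡ ∑³ (λ a b c → ascending∧ a b c (P a b c))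
  count3-∑³ {n} G P =
    trans (sum-concatMap-tabulate (λ a → a) (λ a → concatMap (λ b → map (entry a b) (allFin n)) (allFin n)))
    (sum-cong-≗ (λ a → trans (sum-concatMap-tabulate (λ b → b) (λ b → map (entry a b) (allFin n)))
    (sum-cong-≗ (λ b → sum-map-tabulate (λ c → c) (entry a b)))))
    where
    entry : Fin n → Fin n → Fin n → ℕ
    entry a b c = if ⌊ a <? b ⌋ ∧ ⌊ b <? c ⌋ ∧ P a b c then 1 else 0

  -- The weight

  -- For a pair (v, a): s, o, i record whether a = v, v → a and a → v.
  outᵇ inᵇ nonᵇ : Bool → Bool → Bool → ℤ
  outᵇ s o i = ⟦ not s ∧ o ⟧
  inᵇ  s o i = ⟦ not s ∧ i ⟧
  nonᵇ s o i = ⟦ not (s ∨ o ∨ i) ⟧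

  coordᵇ : Fin 4 → Bool → Bool → Bool → ℤ
  coordᵇ 0F s o i = outᵇ s o i - nonᵇ s o i
  coordᵇ 1F s o i = inᵇ s o i - nonᵇ s o i
  coordᵇ 2F s o i = outᵇ s o i
  coordᵇ 3F s o i = inᵇ s o i

  weightᵇ : (s o i s′ o′ i′ : Bool) → ℤ
  weightᵇ s o i s′ o′ i′ = ∑[ k < 4 ] (coordᵇ k s o i * coordᵇ k s′ o′ i′)

  outᵇ+inᵇ+nonᵇ : ∀ s o i → T (not (o ∧ i)) → outᵇ s o i + inᵇ s o i + nonᵇ s o i ≡ + 1 - ⟦ s ⟧
  outᵇ+inᵇ+nonᵇ true  o     i     _ = refl
  outᵇ+inᵇ+nonᵇ false true  false _ = refl
  outᵇ+inᵇ+nonᵇ false false true  _ = refl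
  outᵇ+inᵇ+nonᵇ false false false _ = refl

  weightᵇ-selfʳ : ∀ s o i o′ i′ → weightᵇ s o i true o′ i′ ≡ + 0
  weightᵇ-selfʳ true  o     i     o′ i′ = refl
  weightᵇ-selfʳ false true  true  o′ i′ = refl
  weightᵇ-selfʳ false true  false o′ i′ = refl
  weightᵇ-selfʳ false false true  o′ i′ = refl
  weightᵇ-selfʳ false false false o′ i′ = refl

  weightᵇ-diagonal : ∀ o i → T (not (o ∧ i)) → weightᵇ false o i false o i ≤ + 2
  weightᵇ-diagonal true  false _ = ≤-refl
  weightᵇ-diagonal false true  _ = ≤-refl
  weightᵇ-diagonal false false _ = ≤-refl

  square-nonNeg : ∀ x → + 0 ≤ x * x
  square-nonNeg +0       = +≤+ z≤n
  square-nonNeg +[1+ k ] = +≤+ z≤n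
  square-nonNeg -[1+ k ] = +≤+ z≤n

  square-of-sum≤ : ∀ p q r →
    (p + q + r) * (p + q + r) ≤ + 5 * ((p - r) * (p - r) + (q - r) * (q - r) + p * p + q * q)
  square-of-sum≤ p q r = begin
    (p + q + r) * (p + q + r)
      ≤⟨ i≤i+j _ _ {{ℤ.nonNegative (+-mono-≤ (square-nonNeg (+ 2 * p + + 2 * q - + 3 * r))
                                              (*-monoˡ-≤-nonNeg (+ 5) (square-nonNeg (p - q))))}} ⟩
    (p + q + r) * (p + q + r) + ((+ 2 * p + + 2 * q - + 3 * r) * (+ 2 * p + + 2 * q - + 3 * r) + + 5 * ((p - q) * (p - q)))
      ≡⟨ sum-of-squares p q r ⟩
    + 5 * ((p - r) * (p - r) + (q - r) * (q - r) + p * p + q * q)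
      ∎
    where
    open ≤-Reasoning
    sum-of-squares : ∀ p q r →
      (p + q + r) * (p + q + r) + ((+ 2 * p + + 2 * q - + 3 * r) * (+ 2 * p + + 2 * q - + 3 * r) + + 5 * ((p - q) * (p - q)))
      ≡ + 5 * ((p - r) * (p - r) + (q - r) * (q - r) + p * p + q * q)
    sum-of-squares = solve-∀

  ⟦⟧-split : ∀ b x → x ≡ ⟦ b ⟧ * x + ⟦ not b ⟧ * x
  ⟦⟧-split true  x = sym (trans (+-identityʳ _) (*-identityˡ x))
  ⟦⟧-split false x = sym (trans (+-identityˡ _) (*-identityˡ x))

  ∑³-diagonal : ∀ n c → ∑³ {n} (λ x y z → c * ⟦ ⌊ y ≟ z ⌋ ⟧) ≡ + n * (+ n * c)
  ∑³-diagonal n c = begin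
    ∑[ x < n ] ∑[ y < n ] ∑[ z < n ] (c * ⟦ ⌊ y ≟ z ⌋ ⟧)
      ≡⟨ sum-cong-≗ {n} (λ x → sum-cong-≗ {n} (λ y → *-distribˡ-sum c (λ z → ⟦ ⌊ y ≟ z ⌋ ⟧))) ⟨
    ∑[ x < n ] ∑[ y < n ] (c * ∑[ z < n ] ⟦ ⌊ y ≟ z ⌋ ⟧)
      ≡⟨ sum-cong-≗ {n} (λ x → sum-cong-≗ {n} (λ y → trans (cong (c *_) (∑-indicator-≟ y)) (*-identityʳ c))) ⟩
    ∑[ x < n ] ∑[ y < n ] c
      ≡⟨ trans (sum-cong-≗ {n} (λ x → ∑-const n c)) (∑-const n (+ n * c)) ⟩
    + n * (+ n * c)
      ∎
    where open ≡-Reasoning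

  module _ {n : ℕ} (G : OrientedGraph n) where

    no-antiparallel : ∀ u v → T (not (adj G u v ∧ adj G v u))
    no-antiparallel u v with adj G u v in uv
    ... | false = tt
    ... | true rewrite antisym G u v uv = tt

    out inn non : Fin n → Fin n → ℤ
    out v a = outᵇ ⌊ v ≟ a ⌋ (adj G v a) (adj G a v)
    inn v a = inᵇ ⌊ v ≟ a ⌋ (adj G v a) (adj G a v)
    non v a = nonᵇ ⌊ v ≟ a ⌋ (adj G v a) (adj G a v)

    coord : Fin 4 → Fin n → Fin n → ℤ
    coord k v a = coordᵇ k ⌊ v ≟ a ⌋ (adj G v a) (adj G a v)

    weight : Fin n → Fin n → Fin n → ℤ
    weight v a b = weightᵇ ⌊ v ≟ a ⌋ (adj G v a) (adj G a v) ⌊ v ≟ b ⌋ (adj G v b) (adj G b v)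

    vertexWeight : Fin n → ℤ
    vertexWeight v = ∑[ a < n ] ∑[ b < n ] weight v a b

    degree-sum : ∀ v → sum (out v) + sum (inn v) + sum (non v) ≡ + n - + 1
    degree-sum v = begin
      sum (out v) + sum (inn v) + sum (non v)       ≡⟨ cong (_+ sum (non v)) (∑-distrib-+ (out v) (inn v)) ⟨
      ∑[ a < n ] (out v a + inn v a) + sum (non v)  ≡⟨ ∑-distrib-+ (λ a → out v a + inn v a) (non v) ⟨
      ∑[ a < n ] (out v a + inn v a + non v a)
        ≡⟨ sum-cong-≗ (λ a → outᵇ+inᵇ+nonᵇ ⌊ v ≟ a ⌋ (adj G v a) (adj G a v) (no-antiparallel v a)) ⟩
      ∑[ a < n ] (+ 1 - ⟦ ⌊ v ≟ a ⌋ ⟧)              ≡⟨ ∑-distrib-- (λ _ → + 1) (λ a → ⟦ ⌊ v ≟ a ⌋ ⟧) ⟩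
      ∑[ a < n ] (+ 1) - ∑[ a < n ] ⟦ ⌊ v ≟ a ⌋ ⟧
        ≡⟨ cong₂ _-_ (trans (∑-const n (+ 1)) (*-identityʳ (+ n))) (∑-indicator-≟ v) ⟩
      + n - + 1                                     ∎
      where open ≡-Reasoning

    vertexWeight-lower : ∀ v → (+ n - + 1) * (+ n - + 1) ≤ + 5 * vertexWeight v
    vertexWeight-lower v = begin
      (+ n - + 1) * (+ n - + 1)
        ≡⟨ cong (λ m → m * m) (degree-sum v) ⟨
      (P + Q + R) * (P + Q + R)
        ≤⟨ square-of-sum≤ P Q R ⟩
      + 5 * ((P - R) * (P - R) + (Q - R) * (Q - R) + P * P + Q * Q)
        ≡⟨ cong (λ W → + 5 * W) (cong₂ (λ A B → A * A + B * B + P * P + Q * Q)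
                                       (∑-distrib-- (out v) (non v)) (∑-distrib-- (inn v) (non v))) ⟨
      + 5 * (S 0F * S 0F + S 1F * S 1F + S 2F * S 2F + S 3F * S 3F)
        ≡⟨ cong (λ W → + 5 * W) (flatten (S 0F * S 0F) (S 1F * S 1F) (S 2F * S 2F) (S 3F * S 3F)) ⟨
      + 5 * ∑[ k < 4 ] (S k * S k)
        ≡⟨ cong (λ W → + 5 * W) (∑∑-gram (λ k → coord k v)) ⟨
      + 5 * vertexWeight v
        ∎
      where
      open ≤-Reasoning
      P = sum (out v)
      Q = sum (inn v)
      R = sum (non v)
      S : Fin 4 → ℤ
      S k = sum (coord k v)
      flatten : ∀ a b c d → a + (b + (c + (d + + 0))) ≡ a + b + c + d
      flatten = solve-∀

    ∑³-weight-lower : + n * ((+ n - + 1) * (+ n - + 1)) ≤ + 5 * ∑³ weight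
    ∑³-weight-lower = begin
      + n * ((+ n - + 1) * (+ n - + 1))         ≡⟨ ∑-const n _ ⟨
      ∑[ v < n ] ((+ n - + 1) * (+ n - + 1))    ≤⟨ ∑-mono-≤ vertexWeight-lower ⟩
      ∑[ v < n ] (+ 5 * vertexWeight v)         ≡⟨ *-distribˡ-sum (+ 5) vertexWeight ⟨
      + 5 * ∑³ weight                           ∎
      where open ≤-Reasoning

    degenerate-weight≤ : ∀ v a b → ⟦ not (distinct v a b) ⟧ * weight v a b ≤ + 2 * ⟦ ⌊ a ≟ b ⌋ ⟧
    degenerate-weight≤ v a b with v ≟ a | a ≟ b | v ≟ b
    ... | yes refl | yes refl | _        = +≤+ z≤n
    ... | yes refl | no _     | _        = ≤-refl
    ... | no v≢a   | yes refl | yes refl = ⊥-elim (v≢a refl)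
    ... | no _     | yes refl | no _     =
      ≤-trans (≤-reflexive (*-identityˡ _)) (weightᵇ-diagonal (adj G v a) (adj G a v) (no-antiparallel v a))
    ... | no _     | no _     | yes refl =
      ≤-reflexive (trans (*-identityˡ _) (weightᵇ-selfʳ false (adj G v a) (adj G a v) (adj G v v) (adj G v v)))
    ... | no _     | no _     | no _     = ≤-refl

    -- For distinct x, y, z the six weights only depend on the six arc bits, which are checked
    -- exhaustively.
    symmetrise-weight≤ : ∀ {x y z} → x < y → y < z →
      symmetrise weight x y z ≤ + 12 * (⟦ transitiveTri G x y z ⟧ + ⟦ independent3 G x y z ⟧)
    symmetrise-weight≤ {x} {y} {z} x<y y<z
      rewrite symmetrise-expand weight x y z
            | ⌊⌋-false (x ≟ y) (<⇒≢ x<y) | ⌊⌋-false (y ≟ x) (≢-sym (<⇒≢ x<y))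
            | ⌊⌋-false (y ≟ z) (<⇒≢ y<z) | ⌊⌋-false (z ≟ y) (≢-sym (<⇒≢ y<z))
            | ⌊⌋-false (x ≟ z) (<⇒≢ (<-trans x<y y<z)) | ⌊⌋-false (z ≟ x) (≢-sym (<⇒≢ (<-trans x<y y<z)))
      = toWitness (by-evaluation 6 oriented bounded tt
          (adj G x y ∷ adj G y x ∷ adj G y z ∷ adj G z y ∷ adj G x z ∷ adj G z x ∷ [])
          (∧-intro (no-antiparallel x y) (∧-intro (no-antiparallel y z) (no-antiparallel x z))))
      where
      oriented bounded : Vec Bool 6 → Bool
      oriented (ab ∷ ba ∷ bc ∷ cb ∷ ac ∷ ca ∷ []) = not (ab ∧ ba) ∧ not (bc ∧ cb) ∧ not (ac ∧ ca)
      bounded (ab ∷ ba ∷ bc ∷ cb ∷ ac ∷ ca ∷ []) =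
        ⌊ weightᵇ false ab ba false ac ca + weightᵇ false ac ca false ab ba
          + weightᵇ false ba ab false bc cb + weightᵇ false bc cb false ba ab
          + weightᵇ false ca ac false cb bc + weightᵇ false cb bc false ca ac
          ℤ.≤? + 12 * (⟦ (ab ∨ ba) ∧ (bc ∨ cb) ∧ (ac ∨ ca) ∧ not ((ab ∧ bc ∧ ca) ∨ (ac ∧ cb ∧ ba)) ⟧
                     + ⟦ not (ab ∨ ba) ∧ not (bc ∨ cb) ∧ not (ac ∨ ca) ⟧) ⌋

    ascending-weight≤ : ∀ x y z → ⟦ ascending x y z ⟧ * symmetrise weight x y z ≤
      + 12 * (ascending∧ x y z (transitiveTri G x y z) + ascending∧ x y z (independent3 G x y z))
    ascending-weight≤ x y z with x <? y | y <? z
    ... | yes x<y | yes y<z = ≤-trans (≤-reflexive (*-identityˡ _)) (symmetrise-weight≤ x<y y<z)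
    ... | yes _   | no _    = ≤-refl
    ... | no _    | _       = ≤-refl

    ∑³-weight-upper : ∑³ weight ≤ + 12 * + (T# G ℕ.+ I# G) + + n * (+ n * + 2)
    ∑³-weight-upper = begin
      ∑³ weight
        ≡⟨ ∑³-cong (λ v a b → ⟦⟧-split (distinct v a b) (weight v a b)) ⟩
      ∑³ (λ v a b → distinctPart v a b + degeneratePart v a b)
        ≡⟨ ∑³-distrib-+ distinctPart degeneratePart ⟩
      ∑³ distinctPart + ∑³ degeneratePart
        ≡⟨ cong (_+ ∑³ degeneratePart) (∑³-distinct weight) ⟩
      ∑³ (λ x y z → ⟦ ascending x y z ⟧ * symmetrise weight x y z) + ∑³ degeneratePart
        ≤⟨ +-mono-≤ (∑³-mono-≤ ascending-weight≤) (∑³-mono-≤ degenerate-weight≤) ⟩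
      ∑³ (λ x y z → + 12 * transitiveOrIndependent x y z) + ∑³ {n} (λ v a b → + 2 * ⟦ ⌊ a ≟ b ⌋ ⟧)
        ≡⟨ cong₂ _+_ (trans (∑³-*ˡ (+ 12) transitiveOrIndependent) (cong (+ 12 *_) ∑³-transitiveOrIndependent))
                     (∑³-diagonal n (+ 2)) ⟩
      + 12 * + (T# G ℕ.+ I# G) + + n * (+ n * + 2)
        ∎
      where
      open ≤-Reasoning
      distinctPart degeneratePart transitive independent transitiveOrIndependent : Fin n → Fin n → Fin n → ℤ
      distinctPart v a b = ⟦ distinct v a b ⟧ * weight v a b
      degeneratePart v a b = ⟦ not (distinct v a b) ⟧ * weight v a b
      transitive x y z = ascending∧ x y z (transitiveTri G x y z)
      independent x y z = ascending∧ x y z (independent3 G x y z)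
      transitiveOrIndependent x y z = transitive x y z + independent x y z
      ∑³-transitiveOrIndependent : ∑³ transitiveOrIndependent ≡ + (T# G ℕ.+ I# G)
      ∑³-transitiveOrIndependent = begin-equality
        ∑³ transitiveOrIndependent     ≡⟨ ∑³-distrib-+ transitive independent ⟩
        ∑³ transitive + ∑³ independent
          ≡⟨ cong₂ _+_ (count3-∑³ G (transitiveTri G)) (count3-∑³ G (independent3 G)) ⟨
        + T# G + + I# G                ≡⟨ pos-+ (T# G) (I# G) ⟨
        + (T# G ℕ.+ I# G)              ∎

    T#+I#-lower : + n * ((+ n - + 1) * (+ n - + 1)) ≤ + 60 * + (T# G ℕ.+ I# G) + + 10 * (+ n * + n)
    T#+I#-lower = begin
      + n * ((+ n - + 1) * (+ n - + 1))         ≤⟨ ∑³-weight-lower ⟩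
      + 5 * ∑³ weight                           ≤⟨ *-monoˡ-≤-nonNeg (+ 5) ∑³-weight-upper ⟩
      + 5 * (+ 12 * X + + n * (+ n * + 2))      ≡⟨ distribute X (+ n) ⟩
      + 60 * X + + 10 * (+ n * + n)             ∎
      where
      open ≤-Reasoning
      X = + (T# G ℕ.+ I# G)
      distribute : ∀ X m → + 5 * (+ 12 * X + m * (m * + 2)) ≡ + 60 * X + + 10 * (m * m)
      distribute = solve-∀

  -- From the cubic inequality to the rational bound

  choose-suc : ∀ n k → + (suc n C suc k) ≡ + (n C k) + + (n C suc k)
  choose-suc n k = trans (cong +_ (sym (nCk+nC[k+1]≡[n+1]C[k+1] n k))) (pos-+ (n C k) (n C suc k))

  2[nC2]≡n[n-1] : ∀ n → + 2 * + (n C 2) ≡ + n * (+ n - + 1)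
  2[nC2]≡n[n-1] zero    = refl
  2[nC2]≡n[n-1] (suc n) = begin
    + 2 * + (suc n C 2)                  ≡⟨ cong (+ 2 *_) (choose-suc n 1) ⟩
    + 2 * (+ (n C 1) + + (n C 2))        ≡⟨ *-distribˡ-+ (+ 2) (+ (n C 1)) (+ (n C 2)) ⟩
    + 2 * + (n C 1) + + 2 * + (n C 2)    ≡⟨ cong₂ (λ a b → + 2 * + a + b) (nC1≡n n) (2[nC2]≡n[n-1] n) ⟩
    + 2 * + n + + n * (+ n - + 1)        ≡⟨ pascal (+ n) ⟩
    (+ 1 + + n) * (+ 1 + + n - + 1)      ≡⟨ cong (λ m → m * (m - + 1)) (pos-+ 1 n) ⟨
    + suc n * (+ suc n - + 1)            ∎
    where
    open ≡-Reasoning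
    pascal : ∀ m → + 2 * m + m * (m - + 1) ≡ (+ 1 + m) * (+ 1 + m - + 1)
    pascal = solve-∀

  6[nC3]≡n[n-1][n-2] : ∀ n → + 6 * + (n C 3) ≡ + n * (+ n - + 1) * (+ n - + 2)
  6[nC3]≡n[n-1][n-2] zero    = refl
  6[nC3]≡n[n-1][n-2] (suc n) = begin
    + 6 * + (suc n C 3)                          ≡⟨ cong (+ 6 *_) (choose-suc n 2) ⟩
    + 6 * (+ (n C 2) + + (n C 3))                ≡⟨ regroup (+ (n C 2)) (+ (n C 3)) ⟩
    + 3 * (+ 2 * + (n C 2)) + + 6 * + (n C 3)
      ≡⟨ cong₂ (λ a b → + 3 * a + b) (2[nC2]≡n[n-1] n) (6[nC3]≡n[n-1][n-2] n) ⟩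
    + 3 * (+ n * (+ n - + 1)) + + n * (+ n - + 1) * (+ n - + 2)
      ≡⟨ pascal (+ n) ⟩
    (+ 1 + + n) * (+ 1 + + n - + 1) * (+ 1 + + n - + 2)
      ≡⟨ cong (λ m → m * (m - + 1) * (m - + 2)) (pos-+ 1 n) ⟨
    + suc n * (+ suc n - + 1) * (+ suc n - + 2)  ∎
    where
    open ≡-Reasoning
    regroup : ∀ a b → + 6 * (a + b) ≡ + 3 * (+ 2 * a) + + 6 * b
    regroup = solve-∀
    pascal : ∀ m → + 3 * (m * (m - + 1)) + m * (m - + 1) * (m - + 2) ≡ (+ 1 + m) * (+ 1 + m - + 1) * (+ 1 + m - + 2)
    pascal = solve-∀

  *-nonNeg : ∀ {i j} → + 0 ≤ i → + 0 ≤ j → + 0 ≤ i * j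
  *-nonNeg {j = j} 0≤i 0≤j = *-monoʳ-≤-nonNeg j {{ℤ.nonNegative 0≤j}} 0≤i

  d[9n+1]≤10m[n-1][n-2] : ∀ {d m n} → + 0 ≤ d → + 1 ≤ m → d + + 3 ≤ n →
                           d * (+ 9 * n + + 1) ≤ + 10 * m * ((n - + 1) * (n - + 2))
  d[9n+1]≤10m[n-1][n-2] {d} {m} {n} 0≤d 1≤m d+3≤n =
    0≤i-j⇒j≤i (subst (+ 0 ≤_) (sym (slack d m n))
      (+-mono-≤ (+-mono-≤ (+-mono-≤ term₁ term₂) (+≤+ z≤n)) term₃))
    where
    k = n - (d + + 3)
    p = m - + 1
    0≤k : + 0 ≤ k
    0≤k = i≤j⇒0≤j-i d+3≤n
    0≤d+c+k : ∀ c → + 0 ≤ d + + c + k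
    0≤d+c+k c = +-mono-≤ (+-mono-≤ 0≤d (+≤+ z≤n)) 0≤k
    term₁ : + 0 ≤ d * (d + + 2 + + 11 * k)
    term₁ = *-nonNeg 0≤d (+-mono-≤ (+-mono-≤ 0≤d (+≤+ z≤n)) (*-monoˡ-≤-nonNeg (+ 11) 0≤k))
    term₂ : + 0 ≤ + 10 * (k * (k + + 3))
    term₂ = *-monoˡ-≤-nonNeg (+ 10) (*-nonNeg 0≤k (+-mono-≤ 0≤k (+≤+ z≤n)))
    term₃ : + 0 ≤ + 10 * (p * ((d + + 2 + k) * (d + + 1 + k)))
    term₃ = *-monoˡ-≤-nonNeg (+ 10) (*-nonNeg (i≤j⇒0≤j-i 1≤m) (*-nonNeg (0≤d+c+k 2) (0≤d+c+k 1)))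
    slack : ∀ d m n → let k = n - (d + + 3); p = m - + 1 in
      + 10 * m * ((n - + 1) * (n - + 2)) - d * (+ 9 * n + + 1)
      ≡ d * (d + + 2 + + 11 * k) + + 10 * (k * (k + + 3)) + + 20 + + 10 * (p * ((d + + 2 + k) * (d + + 1 + k)))
    slack = solve-∀

  [d-10m]C≤10dX : ∀ {d m n C X} → + 0 ≤ d → + 0 ≤ n →
    + 6 * C ≡ n * (n - + 1) * (n - + 2) →
    n * ((n - + 1) * (n - + 1)) ≤ + 60 * X + + 10 * (n * n) →
    d * (+ 9 * n + + 1) ≤ + 10 * m * ((n - + 1) * (n - + 2)) →
    (d - + 10 * m) * C ≤ + 10 * d * X
  [d-10m]C≤10dX {d} {m} {n} {C} {X} 0≤d 0≤n 6C≡ cubic margin =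
    0≤i-j⇒j≤i (*-cancelˡ-≤-pos (+ 0) _ (+ 6) (subst (+ 0 ≤_) (sym six-gap)
      (+-mono-≤ (*-nonNeg 0≤d (i≤j⇒0≤j-i cubic)) (*-nonNeg 0≤n (i≤j⇒0≤j-i margin)))))
    where
    six-gap : + 6 * (+ 10 * d * X - (d - + 10 * m) * C)
              ≡ d * (+ 60 * X + + 10 * (n * n) - n * ((n - + 1) * (n - + 1)))
                + n * (+ 10 * m * ((n - + 1) * (n - + 2)) - d * (+ 9 * n + + 1))
    six-gap = begin
      + 6 * (+ 10 * d * X - (d - + 10 * m) * C)
        ≡⟨ pull-out-6C d m X C ⟩
      + 60 * d * X - (d - + 10 * m) * (+ 6 * C)
        ≡⟨ cong (λ c → + 60 * d * X - (d - + 10 * m) * c) 6C≡ ⟩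
      + 60 * d * X - (d - + 10 * m) * (n * (n - + 1) * (n - + 2))
        ≡⟨ certificate d m n X ⟩
      d * (+ 60 * X + + 10 * (n * n) - n * ((n - + 1) * (n - + 1)))
        + n * (+ 10 * m * ((n - + 1) * (n - + 2)) - d * (+ 9 * n + + 1))
        ∎
      where
      open ≡-Reasoning
      pull-out-6C : ∀ d m X C → + 6 * (+ 10 * d * X - (d - + 10 * m) * C) ≡ + 60 * d * X - (d - + 10 * m) * (+ 6 * C)
      pull-out-6C = solve-∀
      certificate : ∀ d m n X → + 60 * d * X - (d - + 10 * m) * (n * (n - + 1) * (n - + 2))
        ≡ d * (+ 60 * X + + 10 * (n * n) - n * ((n - + 1) * (n - + 1)))
          + n * (+ 10 * m * ((n - + 1) * (n - + 2)) - d * (+ 9 * n + + 1))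
      certificate = solve-∀

  [1/10-ε]C≤X : ∀ (ε : ℚ) (C X : ℕ) →
    (↧ ε - + 10 * ↥ ε) * + C ≤ + 10 * ↧ ε * + X → ((+ 1 / 10) ℚ.- ε) ℚ.* ℕ→ℚ C ℚ.≤ ℕ→ℚ X
  [1/10-ε]C≤X ε@(mkℚ num den-1 _) C X h =
    toℚᵘ-cancel-≤ (ℚᵘ.≤-respˡ-≃ (ℚᵘ.≃-sym lhs) (ℚᵘ.≤-respʳ-≃ (ℚᵘ.≃-sym (ℕ→ℚᵘ X))
      (*≤* (subst₂ _≤_ (numerator≡ (↧ ε) num (+ C)) denominator≡ h))))
    where
    ℕ→ℚᵘ : ∀ m → toℚᵘ (ℕ→ℚ m) ≃ mkℚᵘ (+ m) 0
    ℕ→ℚᵘ m = toℚᵘ-fromℚᵘ (mkℚᵘ (+ m) 0)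
    lhs : toℚᵘ (((+ 1 / 10) ℚ.- ε) ℚ.* ℕ→ℚ C)
          ≃ (mkℚᵘ (+ 1) 9 ℚᵘ.+ ℚᵘ.- mkℚᵘ num den-1) ℚᵘ.* mkℚᵘ (+ C) 0
    lhs = ℚᵘ.≃-trans (toℚᵘ-homo-* ((+ 1 / 10) ℚ.- ε) (ℕ→ℚ C))
            (ℚᵘ.*-cong (ℚᵘ.≃-trans (toℚᵘ-homo-+ (+ 1 / 10) (ℚ.- ε))
                                   (ℚᵘ.+-cong (toℚᵘ-fromℚᵘ (mkℚᵘ (+ 1) 9)) (toℚᵘ-homo‿- ε)))
                       (ℕ→ℚᵘ C))
    numerator≡ : ∀ d a c → (d - + 10 * a) * c ≡ (+ 1 * d + - a * + 10) * c * + 1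
    numerator≡ = solve-∀
    denominator≡ : + 10 * ↧ ε * + X ≡ + X * + (10 ℕ.* suc den-1 ℕ.* 1)
    denominator≡ = begin
      + 10 * + suc den-1 * + X              ≡⟨ reorder (+ 10) (+ suc den-1) (+ X) ⟩
      + X * (+ 10 * + suc den-1 * + 1)      ≡⟨ cong (λ m → + X * (m * + 1)) (pos-* 10 (suc den-1)) ⟨
      + X * (+ (10 ℕ.* suc den-1) * + 1)    ≡⟨ cong (+ X *_) (pos-* (10 ℕ.* suc den-1) 1) ⟨
      + X * + (10 ℕ.* suc den-1 ℕ.* 1)      ∎
      where
      open ≡-Reasoning
      reorder : ∀ a d x → a * d * x ≡ x * (a * d * + 1)
      reorder = solve-∀

open import Defs
open import Data.Nat using (ℕ; _≤_; _+_)
open import Data.Nat.Combinatorics using (_C_)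
open import Data.Integer using (+_)
open import Data.Rational using (ℚ; _/_; _-_; _*_; Positive) renaming (_≤_ to _≤ℚ_)
open import Data.Product using (∃-syntax)

open import Data.Nat using (suc; z≤n; s≤s)
open import Data.Integer using (+≤+; +[1+_]) renaming (_≤_ to _≤ℤ_)
open import Data.Integer.Properties using (pos-+)
open import Data.Rational using (mkℚ)
open import Data.Product using (_,_)
open import Relation.Binary.PropositionalEquality using (subst)
open Density using (T#+I#-lower; 6[nC3]≡n[n-1][n-2]; d[9n+1]≤10m[n-1][n-2]; [d-10m]C≤10dX; [1/10-ε]C≤X)

proposition4p3 : (ε : ℚ) → Positive ε →
    ∃[ N ] ((n : ℕ) → N ≤ n → (G : OrientedGraph n) →
      ((+ 1 / 10) - ε) * ℕ→ℚ (n C 3) ≤ℚ ℕ→ℚ (T# G + I# G))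
-- ε = (p + 1) / d with d = suc d-1, and N = d + 3 suffices.
proposition4p3 ε@(mkℚ +[1+ p ] d-1 _) _ = suc d-1 + 3 , λ n N≤n G →
  [1/10-ε]C≤X ε (n C 3) (T# G + I# G)
    ([d-10m]C≤10dX {+ suc d-1} {+ suc p} {+ n} {+ (n C 3)} {+ (T# G + I# G)}
      (+≤+ z≤n) (+≤+ z≤n) (6[nC3]≡n[n-1][n-2] n) (T#+I#-lower G)
      (d[9n+1]≤10m[n-1][n-2] {+ suc d-1} {+ suc p} (+≤+ z≤n) (+≤+ (s≤s z≤n))
        (subst (_≤ℤ + n) (pos-+ (suc d-1) 3) (+≤+ N≤n))))
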